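{- Let $\gamma$ be a proper $n$-edge coloring of a signed simple graph $\Sigma$, let $a,b\in M_n$ with $a$ absent and $b$ present at a vertex $v_0$, and let $K_{a,b}(v_0,v_m)=(v_0,\ldots,v_m)$ be the $a/b$-chain at $v_0$. Suppose a vertex appears twice in it, $v_j=v_s$ with $s>j$, and let $Q$ be the subtrail $(v_j,\ldots,v_s)$. Then $Q$ has an odd number of positive edges.
   Context: A signed graph is $\Sigma=(\Gamma,\sigma)$ with $\Gamma$ a finite simple graph and $\sigma:E(\Gamma)\to\{+,-\}$. An incidence is a pair $(v,e)$ with $v$ an endpoint of $e$. For $n\ge1$, $M_n=\{0,\pm1,\ldots,\pm k\}$ if $n=2k+1$ and $M_n=\{\pm1,\ldots,\pm k\}$ if $n=2k$. An $n$-edge coloring is a map $\gamma$ from incidences to $M_n$ with $\gamma(v,e)=-\sigma(e)\gamma(w,e)$ for each edge $e$ with endpoints $v,w$ (so both incidences of an edge have the same magnitude, called the magnitude of the edge); it is proper if $\gamma(v,e)\neq\gamma(v,f)$ for distinct edges $e,f$ at a common vertex $v$. A color $c$ is present at $v$ if $\gamma(v,e)=c$ for some edge $e$ at $v$, absent otherwise. A trail $(v_0,\ldots,v_m)$ is a sequence of vertices with consecutive ones adjacent and no edge repeated (vertices may repeat). For a trail, $t_i$ denotes the number of positive edges among $v_0v_1,\ldots,v_{i-1}v_i$. If $a$ is absent and $b$ present at $v_0$, the $a/b$-chain at $v_0$, written $K_{a,b}(v_0,v_m)$, is the maximal trail $(v_0,\ldots,v_m)$ starting at $v_0$ such that (1)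 the edge magnitudes alternate between $|b|$ and $|a|$ along it, starting with $|b|$, and (2) $\{\gamma(v_i,v_{i-1}v_i),\gamma(v_i,v_iv_{i+1})\}=\{(-1)^{t_i}a,(-1)^{t_i}b\}$ for all $0<i<m$. -}

module Defs where

open import Data.Nat using (ℕ; zero; suc; _+_; _*_; _∸_; _≤_; _<_; _/_)
open import Data.Integer as ℤ using (ℤ; ∣_∣; -_)
open import Data.Fin using (Fin)
open import Data.Product using (Σ; ∃; ∃-syntax; _×_; _,_)
open import Data.Sum using (_⊎_)
open import Data.Empty using (⊥)
open import Relation.Nullary using (¬_)
open import Relation.Binary.PropositionalEquality using (_≡_; _≢_)

Even : ℕ → Set
Even n = ∃[ k ] n ≡ 2 * k

Odd : ℕ → Set
Odd n = ∃[ k ] n ≡ suc (2 * k)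

negPow : ℕ → ℤ → ℤ
negPow zero x = x
negPow (suc t) x = - negPow t x

-- The color set M_n: with k = ⌊n/2⌋, M_n = {-k..k} if n odd, {-k..k} \ {0} if n even.
InM : ℕ → ℤ → Set
InM n c = ∣ c ∣ ≤ n / 2 × (Even n → c ≢ ℤ.0ℤ)

data Sign : Set where
  pos neg : Sign

_·_ : Sign → ℤ → ℤ
pos · x = x
neg · x = - x

-- Adj is symmetric and irreflexive; edges are unordered pairs {v,w} with Adj v w,
-- and the sign σ of the edge {v,w} is given by σ v w (= σ w v).
record SignedGraph (N : ℕ) : Set₁ where
  field
    Adj      : Fin N → Fin N → Set
    Adj-sym  : ∀ {v w} → Adj v w → Adj w v
    Adj-irr  : ∀ {v} → ¬ Adj v v
    σ        : Fin N → Fin N → Sign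
    σ-sym    : ∀ {v w} → Adj v w → σ v w ≡ σ w v

module _ {N : ℕ} (Σg : SignedGraph N) where
  open SignedGraph Σg

  -- An assignment of colors to incidences: γ v w is the color of the
  -- incidence (v, vw) (only meaningful when Adj v w).
  Incidences : Set
  Incidences = Fin N → Fin N → ℤ

  IsEdgeColoring : ℕ → Incidences → Set
  IsEdgeColoring n γ =
    (∀ {v w} → Adj v w → InM n (γ v w)) ×
    (∀ {v w} → Adj v w → γ v w ≡ - (σ v w · γ w v))

  IsProper : Incidences → Set
  IsProper γ = ∀ {v w w'} → Adj v w → Adj v w' → w ≢ w' → γ v w ≢ γ v w'

  Present : Incidences → Fin N → ℤ → Set
  Present γ v c = ∃[ w ] (Adj v w × γ v w ≡ c)

  Absent : Incidences → Fin N → ℤ → Set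
  Absent γ v c = ¬ Present γ v c

  SameEdge : (ℕ → Fin N) → ℕ → ℕ → Set
  SameEdge p i j = (p i ≡ p j × p (suc i) ≡ p (suc j)) ⊎ (p i ≡ p (suc j) × p (suc i) ≡ p j)

  -- A trail (p 0, ..., p m): consecutive vertices adjacent, no edge repeated.
  -- (Values p i for i > m are irrelevant.)
  IsTrail : (ℕ → Fin N) → ℕ → Set
  IsTrail p m =
    (∀ i → i < m → Adj (p i) (p (suc i))) ×
    (∀ i j → i < j → j < m → ¬ SameEdge p i j)

  posInd : Sign → ℕ
  posInd pos = 1
  posInd neg = 0

  t : (ℕ → Fin N) → ℕ → ℕ
  t p zero = 0
  t p (suc i) = t p i + posInd (σ (p i) (p (suc i)))

  IsChainTrail : Incidences → ℤ → ℤ → Fin N → (ℕ → Fin N) → ℕ → Set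
  IsChainTrail γ a b v₀ p m =
    p 0 ≡ v₀ × IsTrail p m ×
    (∀ i → i < m →
       (Even i → ∣ γ (p i) (p (suc i)) ∣ ≡ ∣ b ∣) ×
       (Odd i → ∣ γ (p i) (p (suc i)) ∣ ≡ ∣ a ∣)) ×
    -- (2) {γ(v_i, v_{i-1}v_i), γ(v_i, v_i v_{i+1})} = {(-1)^{t_i} a, (-1)^{t_i} b}
    (∀ i → 0 < i → i < m →
       let x = γ (p i) (p (i ∸ 1))
           y = γ (p i) (p (suc i))
           a' = negPow (t p i) a
           b' = negPow (t p i) b
       in ∀ z → ((z ≡ x ⊎ z ≡ y) → (z ≡ a' ⊎ z ≡ b')) ×
                ((z ≡ a' ⊎ z ≡ b') → (z ≡ x ⊎ z ≡ y)))

  IsChain : Incidences → ℤ → ℤ → Fin N → (ℕ → Fin N) → ℕ → Set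
  IsChain γ a b v₀ p m =
    IsChainTrail γ a b v₀ p m ×
    (∀ (q : ℕ → Fin N) (m' : ℕ) → m < m' → (∀ i → i ≤ m → q i ≡ p i) →
       ¬ IsChainTrail γ a b v₀ q m')

-- If Q = (v_j, …, v_s) had an even number of positive edges, then (-1)^{t_s} = (-1)^{t_j},
-- so the colour at v_s = v_j of the closing edge v_{s-1}v_s lies in {(-1)^{t_j} a, (-1)^{t_j} b}.
-- At an interior vertex v_j these two colours are already used by the chain edges
-- v_{j-1}v_j and v_jv_{j+1}; at v_0 the colour a is absent and b is used by v_0v_1.
-- By properness the closing edge is one of those chain edges, so the trail repeats an edge.
module Submission where

open import Defs
open import Data.Nat using (ℕ; _+_; _∸_; _≤_; _<_)
open import Data.Integer using (ℤ)
open import Data.Fin using (Fin)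
open import Relation.Binary.PropositionalEquality using (_≡_)

open import Data.Nat using (zero; suc; _*_; z≤n; s≤s)
open import Data.Nat.Properties
  using (+-suc; +-comm; +-assoc; +-identityʳ; m+[n∸m]≡n; m≤n⇒m<n∨m≡n; <-trans; <⇒≤; n<1+n; m<n⇒0<n; ≤-trans)
open import Data.Integer using (-_)
open import Data.Integer.Properties using (neg-involutive; neg-injective)
open import Data.Fin.Properties using (_≟_)
open import Data.Product using (_×_; _,_; proj₁; proj₂; ∃-syntax)
open import Data.Sum using (_⊎_; inj₁; inj₂)
import Data.Sum as Sum
open import Data.Empty using (⊥-elim)
open import Relation.Nullary using (¬_; yes; no)
open import Relation.Binary.PropositionalEquality using (refl; sym; trans; cong; subst; module ≡-Reasoning)

even⊎odd : ∀ n → Even n ⊎ Odd n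
even⊎odd zero = inj₁ (0 , refl)
even⊎odd (suc n) with even⊎odd n
... | inj₁ (k , n≡2k)   = inj₂ (k , cong suc n≡2k)
... | inj₂ (k , n≡2k+1) = inj₁ (suc k , trans (cong suc n≡2k+1) (cong suc (sym (+-suc k (k + 0)))))

negPow-+ : ∀ m n x → negPow (m + n) x ≡ negPow m (negPow n x)
negPow-+ zero    n x = refl
negPow-+ (suc m) n x = cong -_ (negPow-+ m n x)

negPow-even : ∀ k x → negPow (2 * k) x ≡ x
negPow-even zero    x = refl
negPow-even (suc k) x = begin
  negPow (2 * suc k) x              ≡⟨ cong (λ e → negPow (suc e) x) (+-suc k (k + 0)) ⟩
  - - negPow (2 * k) x              ≡⟨ neg-involutive _ ⟩
  negPow (2 * k) x                  ≡⟨ negPow-even k x ⟩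
  x                                 ∎
  where open ≡-Reasoning

·-injective : ∀ sg {x y} → sg · x ≡ sg · y → x ≡ y
·-injective pos eq = eq
·-injective neg eq = neg-injective eq

InChainPair : ℤ → ℤ → ℕ → ℤ → Set
InChainPair a b k x = x ≡ negPow k a ⊎ x ≡ negPow k b

InChainPair-even-shift : ∀ {a b} k l {x} → InChainPair a b (l + 2 * k) x → InChainPair a b l x
InChainPair-even-shift {a} {b} k l = Sum.map (λ e → trans e (drop a)) (λ e → trans e (drop b))
  where
  drop : ∀ c → negPow (l + 2 * k) c ≡ negPow l c
  drop c = trans (negPow-+ l (2 * k) c) (cong (negPow l) (negPow-even k c))

module _ {N : ℕ} (Σg : SignedGraph N) where
  open SignedGraph Σg

  neg-sign-negPow : ∀ sg k c → - (sg · negPow k c) ≡ negPow (k + posInd Σg sg) c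
  neg-sign-negPow pos k c rewrite +-comm k 1 = refl
  neg-sign-negPow neg k c rewrite +-identityʳ k = neg-involutive _

  InChainPair-across : ∀ {a b} sg k {x y} → x ≡ - (sg · y) →
    InChainPair a b k y → InChainPair a b (k + posInd Σg sg) x
  InChainPair-across {a} {b} sg k {x} {y} x≡ = Sum.map (across a) (across b)
    where
    across : ∀ c → y ≡ negPow k c → x ≡ negPow (k + posInd Σg sg) c
    across c e = trans x≡ (trans (cong (λ u → - (sg · u)) e) (neg-sign-negPow sg k c))

  InChainPair-back : ∀ {a b} sg k {x y} → x ≡ - (sg · y) →
    InChainPair a b (k + posInd Σg sg) x → InChainPair a b k y
  InChainPair-back {a} {b} sg k {x} {y} x≡ = Sum.map (back a) (back b)
    where
    back : ∀ c → x ≡ negPow (k + posInd Σg sg) c → y ≡ negPow k c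
    back c e = ·-injective sg (neg-injective (trans (sym x≡) (trans e (sym (neg-sign-negPow sg k c)))))

  t-+ : ∀ (p : ℕ → Fin N) j d → t Σg p (j + d) ≡ t Σg p j + t Σg (λ i → p (j + i)) d
  t-+ p j zero    = trans (cong (t Σg p) (+-identityʳ j)) (sym (+-identityʳ (t Σg p j)))
  t-+ p j (suc d) = begin
    t Σg p (j + suc d)                                  ≡⟨ cong (t Σg p) (+-suc j d) ⟩
    t Σg p (j + d) + posInd Σg (σ (p (j + d)) (p (suc (j + d))))
      ≡⟨ cong (_+ posInd Σg (σ (p (j + d)) (p (suc (j + d))))) (t-+ p j d) ⟩
    t Σg p j + t Σg q d + posInd Σg (σ (q d) (p (suc (j + d))))
      ≡⟨ +-assoc (t Σg p j) (t Σg q d) _ ⟩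
    t Σg p j + (t Σg q d + posInd Σg (σ (q d) (p (suc (j + d)))))
      ≡⟨ cong (λ v → t Σg p j + (t Σg q d + posInd Σg (σ (q d) (p v)))) (sym (+-suc j d)) ⟩
    t Σg p j + t Σg q (suc d)                           ∎
    where
    open ≡-Reasoning
    q : ℕ → Fin N
    q i = p (j + i)

  proper-injective : ∀ {γ} → IsProper Σg γ → ∀ {v w w'} →
    Adj v w → Adj v w' → γ v w ≡ γ v w' → w ≡ w'
  proper-injective proper {w = w} {w'} vw vw' eq with w ≟ w'
  ... | yes w≡w' = w≡w'
  ... | no  w≢w' = ⊥-elim (proper vw vw' w≢w' eq)

  module Chain
    (γ : Incidences Σg)
    (reverse-colour : ∀ {v w} → Adj v w → γ v w ≡ - (σ v w · γ w v))
    (proper : IsProper Σg γ)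
    (a b : ℤ) (v₀ : Fin N) (a-absent : Absent Σg γ v₀ a)
    (p : ℕ → Fin N) (m : ℕ) (chain : IsChainTrail Σg γ a b v₀ p m)
    where

    ChainPair : ℕ → ℤ → Set
    ChainPair i = InChainPair a b (t Σg p i)

    p0≡v₀ : p 0 ≡ v₀
    p0≡v₀ = proj₁ chain

    step-adj : ∀ i → i < m → Adj (p i) (p (suc i))
    step-adj = proj₁ (proj₁ (proj₂ chain))

    no-repeat : ∀ i j → i < j → j < m → ¬ SameEdge Σg p i j
    no-repeat = proj₂ (proj₁ (proj₂ chain))

    in-pair : ∀ i → 0 < i → i < m → ∀ z →
      (z ≡ γ (p i) (p (i ∸ 1)) ⊎ z ≡ γ (p i) (p (suc i))) → ChainPair i z
    in-pair i 0<i i<m z = proj₁ (proj₂ (proj₂ (proj₂ chain)) i 0<i i<m z)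

    pair-used : ∀ i → 0 < i → i < m → ∀ z →
      ChainPair i z → z ≡ γ (p i) (p (i ∸ 1)) ⊎ z ≡ γ (p i) (p (suc i))
    pair-used i 0<i i<m z = proj₂ (proj₂ (proj₂ (proj₂ chain)) i 0<i i<m z)

    reverse-step : ∀ i → i < m →
      γ (p (suc i)) (p i) ≡ - (σ (p i) (p (suc i)) · γ (p i) (p (suc i)))
    reverse-step i i<m = subst (λ sg → γ (p (suc i)) (p i) ≡ - (sg · γ (p i) (p (suc i))))
      (σ-sym (Adj-sym (step-adj i i<m))) (reverse-colour (Adj-sym (step-adj i i<m)))

    incoming-colour : ∀ r → 0 < r → r < m → ChainPair (suc r) (γ (p (suc r)) (p r))
    incoming-colour r 0<r r<m = InChainPair-across (σ (p r) (p (suc r))) (t Σg p r)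
      (reverse-step r r<m) (in-pair r 0<r r<m _ (inj₂ refl))

    first-colour : 1 < m → γ (p 0) (p 1) ≡ b
    first-colour 1<m with InChainPair-back (σ (p 0) (p 1)) 0 (reverse-step 0 (<-trans (n<1+n 0) 1<m))
                            (in-pair 1 (n<1+n 0) 1<m _ (inj₁ refl))
    ... | inj₂ ≡b = ≡b
    ... | inj₁ ≡a = ⊥-elim (a-absent (subst (λ v → Present Σg γ v a) p0≡v₀
                                             (p 1 , step-adj 0 (<-trans (n<1+n 0) 1<m) , ≡a)))

    even-subtrail-pair : ∀ j s {x} → j ≤ s → Even (t Σg (λ i → p (j + i)) (s ∸ j)) →
      ChainPair s x → ChainPair j x
    even-subtrail-pair j s j≤s (k , even) x∈ = InChainPair-even-shift k (t Σg p j)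
      (subst (λ u → InChainPair a b u _) t-s≡t-j+2k x∈)
      where
      open ≡-Reasoning
      t-s≡t-j+2k : t Σg p s ≡ t Σg p j + 2 * k
      t-s≡t-j+2k = begin
        t Σg p s                                      ≡⟨ cong (t Σg p) (sym (m+[n∸m]≡n j≤s)) ⟩
        t Σg p (j + (s ∸ j))                          ≡⟨ t-+ p j (s ∸ j) ⟩
        t Σg p j + t Σg (λ i → p (j + i)) (s ∸ j)     ≡⟨ cong (t Σg p j +_) even ⟩
        t Σg p j + 2 * k                              ∎

    closing-adj : ∀ j r → r < m → p j ≡ p (suc r) → Adj (p j) (p r)
    closing-adj j r r<m pj≡ = subst (λ v → Adj v (p r)) (sym pj≡) (Adj-sym (step-adj r r<m))

    closing-edge-repeats : ∀ j r → j < r → r < m → p j ≡ p (suc r) →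
      ChainPair j (γ (p j) (p r)) → ∃[ i ] i < r × SameEdge Σg p i r
    closing-edge-repeats zero r 0<r r<m p0≡ (inj₁ ≡a) =
      ⊥-elim (a-absent (subst (λ v → Present Σg γ v a) p0≡v₀ (p r , closing-adj 0 r r<m p0≡ , ≡a)))
    closing-edge-repeats zero r 0<r r<m p0≡ (inj₂ ≡b) =
      0 , 0<r , inj₂ (p0≡ , sym pr≡p1)
      where
      1<m : 1 < m
      1<m = ≤-trans (s≤s 0<r) r<m
      pr≡p1 : p r ≡ p 1
      pr≡p1 = proper-injective proper (closing-adj 0 r r<m p0≡) (step-adj 0 (<⇒≤ 1<m))
                (trans ≡b (sym (first-colour 1<m)))
    closing-edge-repeats (suc j) r j<r r<m pj≡ c∈
      with pair-used (suc j) (s≤s z≤n) (<-trans j<r r<m) _ c∈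
    ... | inj₁ ≡back = j , <-trans (n<1+n j) j<r , inj₁ (sym pr≡pj , pj≡)
      where
      pr≡pj : p r ≡ p j
      pr≡pj = proper-injective proper (closing-adj (suc j) r r<m pj≡)
                (Adj-sym (step-adj j (<-trans (<-trans (n<1+n j) j<r) r<m))) ≡back
    ... | inj₂ ≡forward = suc j , j<r , inj₂ (pj≡ , sym pr≡pj+1)
      where
      pr≡pj+1 : p r ≡ p (suc (suc j))
      pr≡pj+1 = proper-injective proper (closing-adj (suc j) r r<m pj≡)
                  (step-adj (suc j) (<-trans j<r r<m)) ≡forward

    closed-subtrail-odd : ∀ j s → j < s → s ≤ m → p j ≡ p s → Odd (t Σg (λ i → p (j + i)) (s ∸ j))
    closed-subtrail-odd j (suc r) (s≤s j≤r) r<m pj≡ps with even⊎odd (t Σg (λ i → p (j + i)) (suc r ∸ j))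
    ... | inj₂ odd  = odd
    ... | inj₁ even with m≤n⇒m<n∨m≡n j≤r
    ...   | inj₂ refl = ⊥-elim (Adj-irr (subst (λ v → Adj v (p (suc j))) pj≡ps (step-adj j r<m)))
    ...   | inj₁ j<r with closing-edge-repeats j r j<r r<m pj≡ps c∈
      where
      c∈ : ChainPair j (γ (p j) (p r))
      c∈ = subst (λ v → ChainPair j (γ v (p r))) (sym pj≡ps)
             (even-subtrail-pair j (suc r) (<⇒≤ (s≤s j≤r)) even
               (incoming-colour r (m<n⇒0<n j<r) r<m))
    ...     | i , i<r , same = ⊥-elim (no-repeat i r i<r r<m same)

mainTheorem12 : ∀ {N : ℕ} (Σg : SignedGraph N) (n : ℕ) → 1 ≤ n →
    (γ : Incidences Σg) → IsEdgeColoring Σg n γ → IsProper Σg γ →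
    (a b : ℤ) → InM n a → InM n b → (v₀ : Fin N) →
    Absent Σg γ v₀ a → Present Σg γ v₀ b →
    (p : ℕ → Fin N) (m : ℕ) → IsChain Σg γ a b v₀ p m →
    (j s : ℕ) → j < s → s ≤ m → p j ≡ p s →
    -- Q = (v_j, ..., v_s), its number of positive edges is odd
    Odd (t Σg (λ i → p (j + i)) (s ∸ j))
mainTheorem12 Σg _ _ γ (_ , reverse-colour) proper a b _ _ v₀ a-absent _ p m (chain , _) =
  Chain.closed-subtrail-odd Σg γ reverse-colour proper a b v₀ a-absent p m chain
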